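{- Let $S_1\subsetneq S_2\subsetneq\cdots\subsetneq S_n$ be a maximal chain of elements of $\mathcal{R}_\pi^\times$. Then $\int h_{S_1}h_{S_2}\cdots h_{S_n}=1$.
   Context: Uniform setting: $r\ge2$, $E=\bigsqcup_{i=1}^nE_i$ with $E_i=\{i^0,\ldots,i^{r-1}\}$. A subset is colored if it meets each $E_i$ in at most one element; $\mathcal{R}_\pi^\times$ is the set of nonempty colored subsets. $A^*(\Sigma^\pi)=\mathbb{Z}[x_S:S\in\mathcal{R}_\pi^\times]/(\mathcal{I}+\mathcal{J})$ with $\mathcal{I}$ generated by $x_Sx_{S'}$ for incomparable $S,S'$ and $\mathcal{J}$ by $\sum_{S\ni e}x_S-\sum_{S\ni e'}x_S$ for distinct $e,e'$ in a common block; $h_U=\sum_{S'\in\mathcal{R}_\pi^\times,\,S'\cap U\ne\emptyset}x_{S'}$. The integral is the degree map, the linear map on degree-$n$ elements with $\int x_{T_1}\cdots x_{T_n}=1$ for each chain $T_1\subsetneq\cdots\subsetneq T_n$ in $\mathcal{R}_\pi^\times$. (The paper phrases this as an integral over the moduli space $\overline{\mathcal{L}}^r_n$, whose Chow ring it identifies with $A^*(\Sigma^\pi)$ via $x_S\mapsto$ boundary divisors, compatibly with degrees.) -}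

module Defs where

open import Data.Nat using (ℕ; zero; suc; _+_)
open import Data.Fin using (Fin) renaming (_≟_ to _≟F_)
open import Data.Fin.Properties using (any?)
open import Data.Maybe using (Maybe; just; nothing)
import Data.Maybe.Properties as MaybeP
open import Data.Vec using (Vec; []; _∷_; lookup)
open import Data.List using (List; []; _∷_; map; concatMap; filter; allFin; length; foldr)
open import Data.List.Relation.Unary.All using (All)
open import Data.List.Relation.Binary.Permutation.Propositional using (_↭_)
open import Data.Integer using (ℤ; 0ℤ) renaming (_+_ to _+ℤ_)
open import Data.Product using (Σ; _×_; _,_)
open import Relation.Binary.PropositionalEquality using (_≡_; _≢_)
open import Relation.Nullary using (Dec; ¬_)
open import Relation.Nullary.Decidable using (_×-dec_)

-- Ground set E = ⊔_{i<n} E_i, E_i = {i^0,…,i^{r-1}}; an element i^a is the pair (i , a).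
-- A colored subset S ⊆ E (meeting each block E_i in at most one element) is encoded
-- canonically as a vector whose i-th entry is  just a  if S ∩ E_i = {i^a}
-- and  nothing  if S ∩ E_i = ∅.
Col : ℕ → ℕ → Set
Col n r = Vec (Maybe (Fin r)) n

_∋_ : ∀ {n r} → Col n r → Fin n × Fin r → Set
S ∋ (i , a) = lookup S i ≡ just a

_∋?_ : ∀ {n r} (S : Col n r) (e : Fin n × Fin r) → Dec (S ∋ e)
S ∋? (i , a) = MaybeP.≡-dec _≟F_ (lookup S i) (just a)

-- nonempty colored subsets: the elements of R_π^×
NonEmpty : ∀ {n r} → Col n r → Set
NonEmpty {n} {r} S = Σ (Fin n) λ i → Σ (Fin r) λ a → S ∋ (i , a)

_⊆c_ : ∀ {n r} → Col n r → Col n r → Set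
S ⊆c T = ∀ i a → S ∋ (i , a) → T ∋ (i , a)

_⊊c_ : ∀ {n r} → Col n r → Col n r → Set
S ⊊c T = (S ⊆c T) × (S ≢ T)

Incomparable : ∀ {n r} → Col n r → Col n r → Set
Incomparable S T = ¬ (S ⊆c T) × ¬ (T ⊆c S)

Meets : ∀ {n r} → Col n r → Col n r → Set
Meets {n} {r} S U = Σ (Fin n) λ i → Σ (Fin r) λ a → (S ∋ (i , a)) × (U ∋ (i , a))

meets? : ∀ {n r} (S U : Col n r) → Dec (Meets S U)
meets? S U = any? λ i → any? λ a → (S ∋? (i , a)) ×-dec (U ∋? (i , a))

allCol : ∀ n r → List (Col n r)
allCol zero r = [] ∷ []
allCol (suc n) r =
  concatMap (λ m → map (m ∷_) (allCol n r)) (nothing ∷ map just (allFin r))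

Σℤ : List ℤ → ℤ
Σℤ = foldr _+ℤ_ 0ℤ

-- Monomials x_{T_1}⋯x_{T_k} are represented by lists [T_1,…,T_k] (up to permutation).
-- Expansion of the product h_{U_1}⋯h_{U_k}, where h_U = Σ_{S' ∩ U ≠ ∅} x_{S'}:
-- the list of all monomials [T_1,…,T_k] with T_j ∩ U_j ≠ ∅ (each appears with coeff. 1).
-- (Any T meeting U is automatically nonempty, hence in R_π^×.)
hExpand : ∀ {n r} → List (Col n r) → List (List (Col n r))
hExpand {n} {r} [] = [] ∷ []
hExpand {n} {r} (U ∷ Us) =
  concatMap (λ T → map (T ∷_) (hExpand Us)) (filter (λ T → meets? T U) (allCol n r))

data Chain {n r : ℕ} : List (Col n r) → Set where
  []  : Chain []
  [-] : ∀ {T} → Chain (T ∷ [])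
  _∷_ : ∀ {T T' Ts} → T ⊊c T' → Chain (T' ∷ Ts) → Chain (T ∷ T' ∷ Ts)

-- A ℤ-linear functional on the degree-n part of ℤ[x_S : S ∈ R_π^×], given by its
-- values φ on degree-n monomials, which descends to A^*(Σ^π) = ℤ[x_S]/(I+J)
-- (i.e. vanishes on (I+J) in degree n) and is 1 on every chain monomial:
-- this is exactly the degree map ∫ on A^n(Σ^π).
record IsDegreeMap (n r : ℕ) (φ : List (Col n r) → ℤ) : Set where
  field
    -- monomials are commutative
    perm-inv : ∀ (xs ys : List (Col n r)) → length xs ≡ n → All NonEmpty xs →
               xs ↭ ys → φ xs ≡ φ ys
    -- vanishes on (degree-n part of) I : m · x_S x_S' with S, S' incomparable
    kills-I  : ∀ (S S' : Col n r) (m : List (Col n r)) →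
               NonEmpty S → NonEmpty S' → All NonEmpty m → length m + 2 ≡ n →
               Incomparable S S' → φ (S ∷ S' ∷ m) ≡ 0ℤ
    -- vanishes on (degree-n part of) J : m · (Σ_{S∋e} x_S − Σ_{S∋e'} x_S), e ≠ e' in E_i
    kills-J  : ∀ (i : Fin n) (a a' : Fin r) → a ≢ a' → (m : List (Col n r)) →
               All NonEmpty m → length m + 1 ≡ n →
               Σℤ (map (λ S → φ (S ∷ m)) (filter (λ S → S ∋? (i , a)) (allCol n r)))
               ≡ Σℤ (map (λ S → φ (S ∷ m)) (filter (λ S → S ∋? (i , a')) (allCol n r)))
    chain-1  : ∀ (Ts : List (Col n r)) → length Ts ≡ n → All NonEmpty Ts → Chain Ts →
               φ Ts ≡ Data.Integer.1ℤ

∫h : ∀ {n r} → (List (Col n r) → ℤ) → List (Col n r) → ℤ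
∫h φ Us = Σℤ (map φ (hExpand Us))

{-# OPTIONS --safe #-}
-- Expand h_{S₁}⋯h_{S_n} one factor at a time, keeping the part x_c already chosen a chain with
-- top C that is "opposite" to S_k: wherever S_k contains i^a, C contains some i^x with x ≠ a.
-- Write S_{k+1} = S_k ∪ {b^e}. A term x_T of h_{S_{k+1}} with T meeting S_k is incomparable
-- with C and dies in I, so h_{S_{k+1}} acts as Σ_{T ∋ b^e} x_T, which by J equals
-- Σ_{T ∋ b^a} x_T for any colour a. If C ∋ b^x, take a ≠ x: every such T is again
-- incomparable with C. Otherwise take a ≠ e: only T ⊋ C survive, each opposite to S_{k+1}.
-- By induction ∫ x_c h_{S_{k+1}}⋯h_{S_n} is 1 if supp C ⊆ supp S_k, the only contribution
-- then being T = C ∪ {b^a}, and 0 otherwise. A maximal chain is saturated,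
-- ∅ ⋖ S₁ ⋖ ⋯ ⋖ S_n, so the theorem is the case c = [] , C = ∅.
module Submission where

open import Defs
open import Algebra.Properties.CommutativeSemigroup using (interchange)
open import Data.Empty using (⊥-elim)
open import Data.Fin using (Fin; zero; suc; punchIn) renaming (_≟_ to _≟F_)
import Data.Fin.Properties as Fin
open import Data.Integer using (ℤ; 0ℤ; 1ℤ) renaming (_+_ to _+ℤ_)
import Data.Integer.Properties as ℤ
open import Data.List
  using (List; []; _∷_; _++_; _∷ʳ_; [_]; map; concatMap; filter; allFin; length; tabulate)
import Data.List.Properties as List
open import Data.List.Relation.Unary.All as All using (All; []; _∷_)
import Data.List.Relation.Unary.All.Properties as All
open import Data.List.Relation.Binary.Permutation.Propositional using (_↭_)
import Data.List.Relation.Binary.Permutation.Propositional.Properties as ↭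
open import Data.Maybe using (Maybe; just; nothing)
import Data.Maybe.Properties as Maybe
open import Data.Nat using (ℕ; zero; suc; _+_; _≤_; _<_; z≤n; s≤s)
import Data.Nat.Properties as ℕ
open import Data.Product using (Σ; _×_; _,_; proj₁; proj₂)
open import Data.Sum using (_⊎_; inj₁; inj₂)
open import Data.Vec using ([]; _∷_; lookup; replicate; _[_]≔_)
import Data.Vec.Properties as Vec
open import Function using (_∘_; id)
open import Level using (0ℓ)
open import Relation.Binary.PropositionalEquality
  using (_≡_; _≢_; refl; sym; trans; cong; cong₂; subst; module ≡-Reasoning)
open import Relation.Nullary using (Dec; yes; no; ¬_)
open import Relation.Nullary.Decidable using (_→-dec_)
open import Relation.Unary using (Pred; Decidable)

private
  variable
    A B : Set
    n r : ℕ

Σℤ-++ : (xs ys : List ℤ) → Σℤ (xs ++ ys) ≡ Σℤ xs +ℤ Σℤ ys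
Σℤ-++ []       ys = sym (ℤ.+-identityˡ _)
Σℤ-++ (x ∷ xs) ys = trans (cong (x +ℤ_) (Σℤ-++ xs ys)) (sym (ℤ.+-assoc x _ _))

Σℤ-cong : {f g : A → ℤ} {xs : List A} → All (λ x → f x ≡ g x) xs → Σℤ (map f xs) ≡ Σℤ (map g xs)
Σℤ-cong []       = refl
Σℤ-cong (p ∷ ps) = cong₂ _+ℤ_ p (Σℤ-cong ps)

Σℤ-zero : {f : A → ℤ} {xs : List A} → All (λ x → f x ≡ 0ℤ) xs → Σℤ (map f xs) ≡ 0ℤ
Σℤ-zero []       = refl
Σℤ-zero (p ∷ ps) = cong₂ _+ℤ_ p (Σℤ-zero ps)

Σℤ-concatMap : (f : B → ℤ) (g : A → List B) (xs : List A) →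
               Σℤ (map f (concatMap g xs)) ≡ Σℤ (map (λ x → Σℤ (map f (g x))) xs)
Σℤ-concatMap f g []       = refl
Σℤ-concatMap f g (x ∷ xs) = begin
  Σℤ (map f (g x ++ concatMap g xs))          ≡⟨ cong Σℤ (List.map-++ f (g x) _) ⟩
  Σℤ (map f (g x) ++ map f (concatMap g xs))  ≡⟨ Σℤ-++ (map f (g x)) _ ⟩
  Σℤ (map f (g x)) +ℤ Σℤ (map f (concatMap g xs))
    ≡⟨ cong (Σℤ (map f (g x)) +ℤ_) (Σℤ-concatMap f g xs) ⟩
  Σℤ (map (λ x → Σℤ (map f (g x))) (x ∷ xs))  ∎
  where open ≡-Reasoning

Σℤ-+ : (f g : A → ℤ) (xs : List A) →
       Σℤ (map (λ x → f x +ℤ g x) xs) ≡ Σℤ (map f xs) +ℤ Σℤ (map g xs)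
Σℤ-+ f g []       = refl
Σℤ-+ f g (x ∷ xs) = trans (cong (f x +ℤ g x +ℤ_) (Σℤ-+ f g xs))
                          (interchange ℤ.+-commutativeSemigroup (f x) (g x) _ _)

Σℤ-swap : (f : A → B → ℤ) (xs : List A) (ys : List B) →
          Σℤ (map (λ x → Σℤ (map (f x) ys)) xs) ≡ Σℤ (map (λ y → Σℤ (map (λ x → f x y) xs)) ys)
Σℤ-swap f []       ys = sym (Σℤ-zero (All.universal (λ _ → refl) ys))
Σℤ-swap f (x ∷ xs) ys = trans (cong (Σℤ (map (f x) ys) +ℤ_) (Σℤ-swap f xs ys))
                              (sym (Σℤ-+ (f x) (λ y → Σℤ (map (λ x → f x y) xs)) ys))

restrict : {P : Pred A 0ℓ} → Decidable P → (A → ℤ) → A → ℤ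
restrict P? f x with P? x
... | yes _ = f x
... | no _  = 0ℤ

restrict-yes : {P : Pred A 0ℓ} (P? : Decidable P) (f : A → ℤ) {x : A} → P x → restrict P? f x ≡ f x
restrict-yes P? f {x} Px with P? x
... | yes _  = refl
... | no ¬Px = ⊥-elim (¬Px Px)

Σℤ-filter : {P : Pred A 0ℓ} (P? : Decidable P) (f : A → ℤ) (xs : List A) →
            Σℤ (map f (filter P? xs)) ≡ Σℤ (map (restrict P? f) xs)
Σℤ-filter P? f []       = refl
Σℤ-filter P? f (x ∷ xs) with P? x
... | yes _ = cong (f x +ℤ_) (Σℤ-filter P? f xs)
... | no _  = trans (Σℤ-filter P? f xs) (sym (ℤ.+-identityˡ _))

Σℤ-filter-cong : {P : Pred A 0ℓ} (P? : Decidable P) {f g : A → ℤ} → (∀ {x} → P x → f x ≡ g x) →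
                 (xs : List A) → Σℤ (map f (filter P? xs)) ≡ Σℤ (map g (filter P? xs))
Σℤ-filter-cong P? f≡g xs = Σℤ-cong (All.map f≡g (All.all-filter P? xs))

Σℤ-tabulate-zero : ∀ {m} (k : Fin m → ℤ) → (∀ x → k x ≡ 0ℤ) → Σℤ (tabulate k) ≡ 0ℤ
Σℤ-tabulate-zero {zero}  k k≡0 = refl
Σℤ-tabulate-zero {suc m} k k≡0 = cong₂ _+ℤ_ (k≡0 zero) (Σℤ-tabulate-zero (k ∘ suc) (k≡0 ∘ suc))

Σℤ-tabulate-delta : ∀ {m} (k : Fin m → ℤ) a → (∀ x → x ≢ a → k x ≡ 0ℤ) → Σℤ (tabulate k) ≡ k a
Σℤ-tabulate-delta k zero k≡0 =
  trans (cong (k zero +ℤ_) (Σℤ-tabulate-zero (k ∘ suc) (λ x → k≡0 (suc x) λ ())))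
        (ℤ.+-identityʳ _)
Σℤ-tabulate-delta k (suc a) k≡0 =
  trans (cong (_+ℤ Σℤ (tabulate (k ∘ suc))) (k≡0 zero λ ()))
        (trans (ℤ.+-identityˡ _)
               (Σℤ-tabulate-delta (k ∘ suc) a (λ x x≢a → k≡0 (suc x) (x≢a ∘ Fin.suc-injective))))

Σℤ-maybe-delta : (g : Maybe (Fin r) → ℤ) (c : Maybe (Fin r)) → (∀ m → m ≢ c → g m ≡ 0ℤ) →
                 Σℤ (map g (nothing ∷ map just (allFin r))) ≡ g c
Σℤ-maybe-delta {r} g c g≡0 = trans (cong (g nothing +ℤ_) just-part) (split c g≡0)
  where
  just-part : Σℤ (map g (map just (allFin r))) ≡ Σℤ (tabulate (g ∘ just))
  just-part = cong Σℤ (trans (sym (List.map-∘ (allFin r))) (List.map-tabulate id (g ∘ just)))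

  split : ∀ c → (∀ m → m ≢ c → g m ≡ 0ℤ) → g nothing +ℤ Σℤ (tabulate (g ∘ just)) ≡ g c
  split nothing  g≡0 =
    trans (cong (g nothing +ℤ_) (Σℤ-tabulate-zero (g ∘ just) (λ x → g≡0 (just x) λ ())))
          (ℤ.+-identityʳ _)
  split (just a) g≡0 =
    trans (cong (_+ℤ Σℤ (tabulate (g ∘ just))) (g≡0 nothing λ ()))
          (trans (ℤ.+-identityˡ _)
                 (Σℤ-tabulate-delta (g ∘ just) a (λ x x≢a → g≡0 (just x) (x≢a ∘ Maybe.just-injective))))

Σℤ-allCol-delta : (f : Col n r → ℤ) (C : Col n r) → (∀ T → T ≢ C → f T ≡ 0ℤ) →
                  Σℤ (map f (allCol n r)) ≡ f C
Σℤ-allCol-delta {zero}      f []      f≡0 = ℤ.+-identityʳ _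
Σℤ-allCol-delta {suc n} {r} f (c ∷ C) f≡0 = begin
  Σℤ (map f (allCol (suc n) r))
    ≡⟨ Σℤ-concatMap f (λ m → map (m ∷_) (allCol n r)) (nothing ∷ map just (allFin r)) ⟩
  Σℤ (map (λ m → Σℤ (map f (map (m ∷_) (allCol n r)))) (nothing ∷ map just (allFin r)))
    ≡⟨ Σℤ-maybe-delta _ c other-heads ⟩
  Σℤ (map f (map (c ∷_) (allCol n r)))
    ≡⟨ cong Σℤ (sym (List.map-∘ (allCol n r))) ⟩
  Σℤ (map (f ∘ (c ∷_)) (allCol n r))
    ≡⟨ Σℤ-allCol-delta (f ∘ (c ∷_)) C (λ T T≢C → f≡0 (c ∷ T) (T≢C ∘ Vec.∷-injectiveʳ)) ⟩
  f (c ∷ C) ∎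
  where
  open ≡-Reasoning
  other-heads : ∀ m → m ≢ c → Σℤ (map f (map (m ∷_) (allCol n r))) ≡ 0ℤ
  other-heads m m≢c = trans (cong Σℤ (sym (List.map-∘ (allCol n r))))
    (Σℤ-zero (All.universal (λ T → f≡0 (m ∷ T) (m≢c ∘ Vec.∷-injectiveˡ)) (allCol n r)))

∅ : Col n r
∅ = replicate _ nothing

nothing≢just : {x : A} → nothing ≢ just x
nothing≢just ()

∅∌ : ∀ i a → ¬ (∅ {n} {r} ∋ (i , a))
∅∌ i a ∅∋ = nothing≢just (trans (sym (Vec.lookup-replicate i nothing)) ∅∋)

∅⊊ : {S : Col n r} → NonEmpty S → ∅ ⊊c S
∅⊊ (i , a , S∋) = (λ j b ∅∋ → ⊥-elim (∅∌ j b ∅∋)) ,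
                  (λ ∅≡S → ∅∌ i a (trans (cong (λ V → lookup V i) ∅≡S) S∋))

_⊆?_ : (S T : Col n r) → Dec (S ⊆c T)
S ⊆? T = Fin.all? λ i → Fin.all? λ a → (S ∋? (i , a)) →-dec (T ∋? (i , a))

clash-incomparable : {C T : Col n r} {i : Fin n} {x a : Fin r} →
                     C ∋ (i , x) → T ∋ (i , a) → a ≢ x → Incomparable C T
clash-incomparable {i = i} {x} {a} C∋ T∋ a≢x =
  (λ C⊆T → a≢x (Maybe.just-injective (trans (sym T∋) (C⊆T i x C∋)))) ,
  (λ T⊆C → a≢x (Maybe.just-injective (trans (sym (T⊆C i a T∋)) C∋)))

lookup-≢ : (S T : Col n r) → S ≢ T → Σ (Fin n) λ i → lookup S i ≢ lookup T i
lookup-≢ []      []      S≢T = ⊥-elim (S≢T refl)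
lookup-≢ (x ∷ S) (y ∷ T) S≢T with Maybe.≡-dec _≟F_ x y
... | no x≢y  = zero , x≢y
... | yes refl with lookup-≢ S T (S≢T ∘ cong (x ∷_))
...   | i , Sᵢ≢Tᵢ = suc i , Sᵢ≢Tᵢ

record Insert (b : Fin n) (e : Fin r) (U V : Col n r) : Set where
  field
    fresh : lookup U b ≡ nothing
    added : V ∋ (b , e)
    same  : ∀ i → i ≢ b → lookup V i ≡ lookup U i

Full : Col n r → Set
Full S = ∀ i → lookup S i ≢ nothing

data Saturated {n r : ℕ} : Col n r → List (Col n r) → Set where
  full : ∀ {U} → Full U → Saturated U []
  _∷_  : ∀ {b e U V L} → Insert b e U V → Saturated V L → Saturated U (V ∷ L)

size : Col n r → ℕ
size []            = 0
size (nothing ∷ S) = size S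
size (just _ ∷ S)  = suc (size S)

size-∅ : size (∅ {n} {r}) ≡ 0
size-∅ {zero}  = refl
size-∅ {suc n} = size-∅ {n}

size≤n : (S : Col n r) → size S ≤ n
size≤n []            = z≤n
size≤n (nothing ∷ S) = ℕ.m≤n⇒m≤1+n (size≤n S)
size≤n (just _ ∷ S)  = s≤s (size≤n S)

size≡n⇒full : (S : Col n r) → size S ≡ n → Full S
size≡n⇒full (nothing ∷ S) size≡ _       _ =
  ℕ.<-irrefl refl (ℕ.≤-trans (ℕ.≤-reflexive (sym size≡)) (size≤n S))
size≡n⇒full (just a ∷ S)  size≡ (suc i)   = size≡n⇒full S (ℕ.suc-injective size≡) i

⊆-tail : {x y : Maybe (Fin r)} {S T : Col n r} → (x ∷ S) ⊆c (y ∷ T) → S ⊆c T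
⊆-tail S⊆T i = S⊆T (suc i)

size-mono : (S T : Col n r) → S ⊆c T → size S ≤ size T
size-mono []            []            _   = z≤n
size-mono (nothing ∷ S) (nothing ∷ T) S⊆T = size-mono S T (⊆-tail S⊆T)
size-mono (nothing ∷ S) (just _ ∷ T)  S⊆T = ℕ.m≤n⇒m≤1+n (size-mono S T (⊆-tail S⊆T))
size-mono (just a ∷ S)  (y ∷ T)       S⊆T with S⊆T zero a refl
... | refl = s≤s (size-mono S T (⊆-tail S⊆T))

⊆∧size≡⇒≡ : (S T : Col n r) → S ⊆c T → size S ≡ size T → S ≡ T
⊆∧size≡⇒≡ []            []            _   _     = refl
⊆∧size≡⇒≡ (nothing ∷ S) (nothing ∷ T) S⊆T size≡ =
  cong (nothing ∷_) (⊆∧size≡⇒≡ S T (⊆-tail S⊆T) size≡)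
⊆∧size≡⇒≡ (nothing ∷ S) (just _ ∷ T)  S⊆T size≡ =
  ⊥-elim (ℕ.<-irrefl refl (ℕ.≤-trans (ℕ.≤-reflexive (sym size≡)) (size-mono S T (⊆-tail S⊆T))))
⊆∧size≡⇒≡ (just a ∷ S)  (y ∷ T)       S⊆T size≡ with S⊆T zero a refl
... | refl = cong (just a ∷_) (⊆∧size≡⇒≡ S T (⊆-tail S⊆T) (ℕ.suc-injective size≡))

⊊⇒size< : {S T : Col n r} → S ⊊c T → size S < size T
⊊⇒size< {S = S} {T} (S⊆T , S≢T) = ℕ.≤∧≢⇒< (size-mono S T S⊆T) (S≢T ∘ ⊆∧size≡⇒≡ S T S⊆T)

insert-there : {b : Fin n} {e : Fin r} {x : Maybe (Fin r)} {U V : Col n r} →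
               Insert b e U V → Insert (suc b) e (x ∷ U) (x ∷ V)
insert-there ins = record
  { fresh = fresh ; added = added
  ; same  = λ { zero _ → refl ; (suc i) i≢b → same i (i≢b ∘ cong suc) } }
  where open Insert ins

⊆∧size≡suc⇒insert : (S T : Col n r) → S ⊆c T → size T ≡ suc (size S) →
                    Σ (Fin n) λ b → Σ (Fin r) λ e → Insert b e S T
⊆∧size≡suc⇒insert (nothing ∷ S) (nothing ∷ T) S⊆T size≡
  with ⊆∧size≡suc⇒insert S T (⊆-tail S⊆T) size≡
... | b , e , ins = suc b , e , insert-there ins
⊆∧size≡suc⇒insert (nothing ∷ S) (just e ∷ T)  S⊆T size≡
  with ⊆∧size≡⇒≡ S T (⊆-tail S⊆T) (sym (ℕ.suc-injective size≡))
... | refl = zero , e , record { fresh = refl ; added = refl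
                               ; same = λ { zero 0≢0 → ⊥-elim (0≢0 refl) ; (suc i) _ → refl } }
⊆∧size≡suc⇒insert (just a ∷ S)  (y ∷ T)       S⊆T size≡ with S⊆T zero a refl
... | refl with ⊆∧size≡suc⇒insert S T (⊆-tail S⊆T) (ℕ.suc-injective size≡)
...   | b , e , ins = suc b , e , insert-there ins

chain-size-bound : {U : Col n r} {L : List (Col n r)} → Chain (U ∷ L) → size U + length L ≤ n
chain-size-bound {U = U} [-] = ℕ.≤-trans (ℕ.≤-reflexive (ℕ.+-identityʳ (size U))) (size≤n U)
chain-size-bound {U = U} {V ∷ L} (U⊊V ∷ chain) = begin
  size U + suc (length L) ≡⟨ ℕ.+-suc (size U) (length L) ⟩
  suc (size U) + length L ≤⟨ ℕ.+-monoˡ-≤ (length L) (⊊⇒size< U⊊V) ⟩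
  size V + length L       ≤⟨ chain-size-bound chain ⟩
  _                       ∎
  where open ℕ.≤-Reasoning

chain-saturated : {U : Col n r} {L : List (Col n r)} → Chain (U ∷ L) → size U + length L ≡ n →
                  Saturated U L
chain-saturated {U = U} [-] size≡ = full (size≡n⇒full U (trans (sym (ℕ.+-identityʳ (size U))) size≡))
chain-saturated {U = U} {V ∷ L} (U⊊V ∷ chain) size≡ =
  proj₂ (proj₂ (⊆∧size≡suc⇒insert U V (proj₁ U⊊V) sizeV≡))
    ∷ chain-saturated chain (trans (cong (_+ length L) sizeV≡) size≡′)
  where
  size≡′ : suc (size U) + length L ≡ _
  size≡′ = trans (sym (ℕ.+-suc (size U) (length L))) size≡
  sizeV≡ : size V ≡ suc (size U)
  sizeV≡ = ℕ.≤-antisym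
    (ℕ.+-cancelʳ-≤ (length L) _ _ (ℕ.≤-trans (chain-size-bound chain) (ℕ.≤-reflexive (sym size≡′))))
    (⊊⇒size< U⊊V)

maximal-chain-saturated : (S : List (Col n r)) → length S ≡ n → All NonEmpty S → Chain S →
                          Saturated ∅ S
maximal-chain-saturated {n} {r} S length≡ nonEmpty chain =
  chain-saturated (∅-∷ nonEmpty chain) (trans (cong (_+ length S) (size-∅ {n} {r})) length≡)
  where
  ∅-∷ : ∀ {S} → All NonEmpty S → Chain S → Chain (∅ ∷ S)
  ∅-∷ []                _     = [-]
  ∅-∷ (S-nonEmpty ∷ _) chain = ∅⊊ S-nonEmpty ∷ chain

data ChainTo {n r : ℕ} : List (Col n r) → Col n r → Set where
  []  : ChainTo [] ∅
  _▸_ : ∀ {c C T} → ChainTo c C → C ⊊c T → ChainTo (c ∷ʳ T) T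

chain-∷ʳ : (c : List (Col n r)) {C T : Col n r} → Chain (c ∷ʳ C) → C ⊊c T → Chain (c ∷ʳ C ∷ʳ T)
chain-∷ʳ []          [-]         C⊊T = C⊊T ∷ [-]
chain-∷ʳ (_ ∷ [])    (p ∷ [-])   C⊊T = p ∷ C⊊T ∷ [-]
chain-∷ʳ (_ ∷ _ ∷ c) (p ∷ chain) C⊊T = p ∷ chain-∷ʳ (_ ∷ c) chain C⊊T

ChainTo⇒Chain : {c : List (Col n r)} {C : Col n r} → ChainTo c C → Chain c
ChainTo⇒Chain []                            = []
ChainTo⇒Chain ([] ▸ _)                      = [-]
ChainTo⇒Chain (chain@(_▸_ {c = c} _ _) ▸ C⊊T) = chain-∷ʳ c (ChainTo⇒Chain chain) C⊊T

Opposite : Col n r → Col n r → Set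
Opposite {r = r} C U = ∀ i a → U ∋ (i , a) → Σ (Fin r) λ x → C ∋ (i , x) × x ≢ a

Supp⊆ : Col n r → Col n r → Set
Supp⊆ C U = ∀ i → lookup U i ≡ nothing → lookup C i ≡ nothing

Supp⊈ : Col n r → Col n r → Set
Supp⊈ {n} C U = Σ (Fin n) λ i → lookup U i ≡ nothing × lookup C i ≢ nothing

opposite-∅ : Opposite (∅ {n} {r}) ∅
opposite-∅ i a ∅∋ = ⊥-elim (∅∌ i a ∅∋)

supp⊆-∅ : Supp⊆ (∅ {n} {r}) ∅
supp⊆-∅ i _ = Vec.lookup-replicate i nothing

opposite-incomparable : {C U T : Col n r} {i : Fin n} {a : Fin r} →
                        Opposite C U → T ∋ (i , a) → U ∋ (i , a) → Incomparable C T
opposite-incomparable {C = C} {T = T} opp T∋ U∋ with opp _ _ U∋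
... | x , C∋ , x≢a = clash-incomparable {C = C} {T} C∋ T∋ (x≢a ∘ sym)

meets-insert : {b : Fin n} {e : Fin r} {U U′ T : Col n r} → Insert b e U U′ → Meets T U′ →
               T ∋ (b , e) ⊎ Σ (Fin n) λ i → Σ (Fin r) λ a → T ∋ (i , a) × U ∋ (i , a)
meets-insert {b = b} ins (i , a , T∋ , U′∋) with i ≟F b
... | yes refl = inj₁ (trans T∋ (trans (sym U′∋) (Insert.added ins)))
... | no i≢b   = inj₂ (i , a , T∋ , trans (sym (Insert.same ins i i≢b)) U′∋)

fresh-⊈ : {C T : Col n r} {b : Fin n} {a : Fin r} → lookup C b ≡ nothing → T ∋ (b , a) → ¬ (T ⊆c C)
fresh-⊈ {b = b} {a} C-fresh T∋ T⊆C = nothing≢just (trans (sym C-fresh) (T⊆C b a T∋))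

fresh-⊊ : {C T : Col n r} {b : Fin n} {a : Fin r} → lookup C b ≡ nothing → T ∋ (b , a) → C ⊆c T → C ⊊c T
fresh-⊊ {C = C} C-fresh T∋ C⊆T = C⊆T , λ { refl → fresh-⊈ {C = C} {C} C-fresh T∋ C⊆T }

fresh-⊆-update : {C : Col n r} {b : Fin n} {a : Fin r} → lookup C b ≡ nothing → C ⊆c (C [ b ]≔ just a)
fresh-⊆-update {C = C} {b} {a} C-fresh i x C∋ with i ≟F b
... | yes refl = ⊥-elim (nothing≢just (trans (sym C-fresh) C∋))
... | no i≢b   = trans (Vec.lookup∘update′ i≢b C (just a)) C∋

opposite-insert : {C U U′ T : Col n r} {b : Fin n} {e a : Fin r} →
                  Opposite C U → Insert b e U U′ → C ⊆c T → T ∋ (b , a) → a ≢ e → Opposite T U′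
opposite-insert {b = b} {a = a} opp ins C⊆T T∋ a≢e i a′ U′∋ with i ≟F b
... | yes refl = a , T∋ , λ { refl → a≢e (Maybe.just-injective (trans (sym U′∋) (Insert.added ins))) }
... | no i≢b with opp i a′ (trans (sym (Insert.same ins i i≢b)) U′∋)
...   | x , C∋ , x≢a′ = x , C⊆T i x C∋ , x≢a′

supp⊈-insert : {C U U′ T : Col n r} {b : Fin n} {e : Fin r} →
               Supp⊈ C U → lookup C b ≡ nothing → Insert b e U U′ → C ⊆c T → Supp⊈ T U′
supp⊈-insert {C = C} {b = b} (i , U-i , C-i) C-fresh ins C⊆T with lookup C i in C∋
... | nothing = ⊥-elim (C-i refl)
... | just x  = i , trans (Insert.same ins i i≢b) U-i , λ T-i → nothing≢just (trans (sym T-i) (C⊆T i x C∋))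
  where
  i≢b : i ≢ b
  i≢b refl = nothing≢just (trans (sym C-fresh) C∋)

supp⊆-insert : {C U U′ : Col n r} {b : Fin n} {e a : Fin r} →
               Supp⊆ C U → Insert b e U U′ → Supp⊆ (C [ b ]≔ just a) U′
supp⊆-insert {C = C} {b = b} {a = a} C⊆U ins i U′-i with i ≟F b
... | yes refl = ⊥-elim (nothing≢just (trans (sym U′-i) (Insert.added ins)))
... | no i≢b   =
  trans (Vec.lookup∘update′ i≢b C (just a)) (C⊆U i (trans (sym (Insert.same ins i i≢b)) U′-i))

supp⊈-off-update : {C U U′ T : Col n r} {b : Fin n} {e a : Fin r} →
                   Opposite C U → Insert b e U U′ → C ⊆c T → T ∋ (b , a) → T ≢ C [ b ]≔ just a →
                   Supp⊈ T U′
supp⊈-off-update {C = C} {U} {T = T} {b} {a = a} opp ins C⊆T T∋ T≢C′ with lookup-≢ T _ T≢C′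
... | i , T-i≢C′-i with i ≟F b
...   | yes refl = ⊥-elim (T-i≢C′-i (trans T∋ (sym (Vec.lookup∘update i C (just a)))))
...   | no i≢b   = i , trans (Insert.same ins i i≢b) U-i , T-i≢C′-i ∘ (λ T-i → trans T-i (sym C′-i))
  where
  C′-i≡C-i : lookup (C [ b ]≔ just a) i ≡ lookup C i
  C′-i≡C-i = Vec.lookup∘update′ i≢b C (just a)

  C-i : lookup C i ≡ nothing
  C-i with lookup C i in C∋
  ... | nothing = refl
  ... | just x  = ⊥-elim (T-i≢C′-i (trans (C⊆T i x C∋) (sym (trans C′-i≡C-i C∋))))

  C′-i : lookup (C [ b ]≔ just a) i ≡ nothing
  C′-i = trans C′-i≡C-i C-i

  U-i : lookup U i ≡ nothing
  U-i with lookup U i in U∋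
  ... | nothing = refl
  ... | just a′ with opp i a′ U∋
  ...   | x , C∋ , _ = ⊥-elim (nothing≢just (trans (sym C-i) C∋))

another : 2 ≤ r → Fin r → Fin r
another (s≤s (s≤s _)) x = punchIn x zero

another-≢ : (2≤r : 2 ≤ r) (x : Fin r) → another 2≤r x ≢ x
another-≢ (s≤s (s≤s _)) x = Fin.punchInᵢ≢i x zero

meeting : Col n r → List (Col n r)
meeting {n} {r} U = filter (λ T → meets? T U) (allCol n r)

containing : Fin n → Fin r → List (Col n r)
containing {n} {r} b a = filter (_∋? (b , a)) (allCol n r)

Monomial : List (Col n r) → Set
Monomial {n} m = All NonEmpty m × length m ≡ n

monomial-++ : {c l : List (Col n r)} {k : ℕ} →
              All NonEmpty c → length c + k ≡ n → All NonEmpty l → length l ≡ k → Monomial (c ++ l)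
monomial-++ {c = c} nonEmpty-c length-c nonEmpty-l refl =
  All.++⁺ nonEmpty-c nonEmpty-l , trans (List.length-++ c) length-c

monomial-↭ : {xs ys : List (Col n r)} → xs ↭ ys → Monomial xs → Monomial ys
monomial-↭ xs↭ys (nonEmpty , length≡) =
  ↭.All-resp-↭ xs↭ys nonEmpty , trans (sym (↭.↭-length xs↭ys)) length≡

hExpand-shape : (Us : List (Col n r)) → All (λ l → All NonEmpty l × length l ≡ length Us) (hExpand Us)
hExpand-shape []       = ([] , refl) ∷ []
hExpand-shape {n} {r} (U ∷ Us) =
  All.concat⁺ (All.map⁺ (All.map (λ {T} → extend {T}) (All.all-filter (λ T → meets? T U) (allCol n r))))
  where
  extend : ∀ {T} → Meets T U →
           All (λ l → All NonEmpty l × length l ≡ length (U ∷ Us)) (map (T ∷_) (hExpand Us))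
  extend (i , a , T∋ , _) =
    All.map⁺ (All.map (λ (nonEmpty , length≡) → (i , a , T∋) ∷ nonEmpty , cong suc length≡)
                      (hExpand-shape Us))

length-∷ʳ : (c : List (Col n r)) {T : Col n r} {k m : ℕ} →
            length c + suc k ≡ m → length (c ∷ʳ T) + k ≡ m
length-∷ʳ c {k = k} length≡ =
  trans (cong (_+ k) (List.length-++ c)) (trans (ℕ.+-assoc (length c) 1 k) length≡)

module Expansion {n r : ℕ} (φ : List (Col n r) → ℤ) (φ-degree : IsDegreeMap n r φ) where
  open IsDegreeMap φ-degree

  -- ∫xh c Us = ∫ x_{c₁}⋯x_{c_k} · h_{U₁}⋯h_{U_m}
  ∫xh : List (Col n r) → List (Col n r) → ℤ
  ∫xh c Us = Σℤ (map (λ l → φ (c ++ l)) (hExpand Us))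

  ∫xh-∷ : (c : List (Col n r)) (U : Col n r) (Us : List (Col n r)) →
          ∫xh c (U ∷ Us) ≡ Σℤ (map (λ T → ∫xh (c ∷ʳ T) Us) (meeting U))
  ∫xh-∷ c U Us = trans (Σℤ-concatMap _ (λ T → map (T ∷_) (hExpand Us)) (meeting U))
                       (Σℤ-cong (All.universal reassociate (meeting U)))
    where
    reassociate : ∀ T → Σℤ (map (λ l → φ (c ++ l)) (map (T ∷_) (hExpand Us))) ≡ ∫xh (c ∷ʳ T) Us
    reassociate T =
      cong Σℤ (trans (sym (List.map-∘ (hExpand Us)))
                     (List.map-cong (λ l → cong φ (sym (List.++-assoc c [ T ] l))) (hExpand Us)))

  φ-incomparable-front : ∀ {C T m} → Monomial (C ∷ T ∷ m) → Incomparable C T → φ (C ∷ T ∷ m) ≡ 0ℤ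
  φ-incomparable-front {C} {T} {m} (C-nonEmpty ∷ T-nonEmpty ∷ m-nonEmpty , length≡) =
    kills-I C T m C-nonEmpty T-nonEmpty m-nonEmpty (trans (ℕ.+-comm _ 2) length≡)

  φ-incomparable : ∀ {c C T} → ChainTo c C → Incomparable C T → (l : List (Col n r)) →
                   Monomial (c ++ T ∷ l) → φ (c ++ T ∷ l) ≡ 0ℤ
  φ-incomparable [] (∅⊈T , _) _ _ = ⊥-elim (∅⊈T λ i a ∅∋ → ⊥-elim (∅∌ i a ∅∋))
  φ-incomparable {T = T} (_▸_ {c = c} {T = C} _ _) C∥T l monomial = begin
    φ ((c ∷ʳ C) ++ T ∷ l)  ≡⟨ cong φ (List.++-assoc c [ C ] (T ∷ l)) ⟩
    φ (c ++ C ∷ T ∷ l)     ≡⟨ perm-inv _ _ (proj₂ monomial′) (proj₁ monomial′) to-front ⟩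
    φ (C ∷ T ∷ c ++ l)     ≡⟨ φ-incomparable-front (monomial-↭ to-front monomial′) C∥T ⟩
    0ℤ                     ∎
    where
    open ≡-Reasoning
    to-front : c ++ C ∷ T ∷ l ↭ C ∷ T ∷ c ++ l
    to-front = ↭.shifts c (C ∷ T ∷ [])
    monomial′ : Monomial (c ++ C ∷ T ∷ l)
    monomial′ = subst Monomial (List.++-assoc c [ C ] (T ∷ l)) monomial

  ∫xh-incomparable : ∀ {c C T} (Us : List (Col n r)) → ChainTo c C → All NonEmpty c → NonEmpty T →
                     Incomparable C T → length c + suc (length Us) ≡ n → ∫xh (c ∷ʳ T) Us ≡ 0ℤ
  ∫xh-incomparable {c} {T = T} Us chain c-nonEmpty T-nonEmpty C∥T degree =
    Σℤ-zero (All.map vanishes (hExpand-shape Us))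
    where
    vanishes : ∀ {l} → All NonEmpty l × length l ≡ length Us → φ ((c ∷ʳ T) ++ l) ≡ 0ℤ
    vanishes {l} (l-nonEmpty , length-l) =
      trans (cong φ (List.++-assoc c [ T ] l))
            (φ-incomparable chain C∥T l
              (monomial-++ c-nonEmpty degree (T-nonEmpty ∷ l-nonEmpty) (cong suc length-l)))

  ∫xh-recolour : ∀ {c} (Us : List (Col n r)) → All NonEmpty c → length c + suc (length Us) ≡ n →
                 (b : Fin n) (a a′ : Fin r) →
                 Σℤ (map (λ T → ∫xh (c ∷ʳ T) Us) (containing b a)) ≡
                 Σℤ (map (λ T → ∫xh (c ∷ʳ T) Us) (containing b a′))
  ∫xh-recolour Us c-nonEmpty degree b a a′ with a ≟F a′
  ... | yes refl = refl
  ∫xh-recolour {c} Us c-nonEmpty degree b a a′ | no a≢a′ = begin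
    Σℤ (map (λ T → Σℤ (map (term T) (hExpand Us))) (containing b a))
      ≡⟨ Σℤ-swap term (containing b a) (hExpand Us) ⟩
    Σℤ (map (λ l → Σℤ (map (λ T → term T l) (containing b a))) (hExpand Us))
      ≡⟨ Σℤ-cong (All.map relation-J (hExpand-shape Us)) ⟩
    Σℤ (map (λ l → Σℤ (map (λ T → term T l) (containing b a′))) (hExpand Us))
      ≡⟨ sym (Σℤ-swap term (containing b a′) (hExpand Us)) ⟩
    Σℤ (map (λ T → Σℤ (map (term T) (hExpand Us))) (containing b a′)) ∎
    where
    open ≡-Reasoning
    term : Col n r → List (Col n r) → ℤ
    term T l = φ ((c ∷ʳ T) ++ l)

    relation-J : ∀ {l} → All NonEmpty l × length l ≡ length Us →
                 Σℤ (map (λ T → term T l) (containing b a)) ≡ Σℤ (map (λ T → term T l) (containing b a′))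
    relation-J {l} (l-nonEmpty , length-l) =
      trans (Σℤ-filter-cong (_∋? (b , a)) (λ T∋ → to-front (b , a , T∋)) (allCol n r))
     (trans (kills-J b a a′ a≢a′ (c ++ l) (All.++⁺ c-nonEmpty l-nonEmpty) degree′)
            (sym (Σℤ-filter-cong (_∋? (b , a′)) (λ T∋ → to-front (b , a′ , T∋)) (allCol n r))))
      where
      to-front : ∀ {T} → NonEmpty T → term T l ≡ φ (T ∷ c ++ l)
      to-front {T} T-nonEmpty =
        trans (cong φ (List.++-assoc c [ T ] l))
              (perm-inv _ _ (proj₂ monomial) (proj₁ monomial) (↭.shift T c l))
        where
        monomial : Monomial (c ++ T ∷ l)
        monomial = monomial-++ c-nonEmpty degree (T-nonEmpty ∷ l-nonEmpty) (cong suc length-l)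
      degree′ : length (c ++ l) + 1 ≡ n
      degree′ = begin
        length (c ++ l) + 1         ≡⟨ ℕ.+-comm _ 1 ⟩
        suc (length (c ++ l))       ≡⟨ cong suc (List.length-++ c) ⟩
        suc (length c + length l)   ≡⟨ sym (ℕ.+-suc (length c) _) ⟩
        length c + suc (length l)   ≡⟨ cong (λ k → length c + suc k) length-l ⟩
        length c + suc (length Us)  ≡⟨ degree ⟩
        n                           ∎

  ∫xh-insert : ∀ {c C U U′ b e} (Us : List (Col n r)) → ChainTo c C → All NonEmpty c →
               Opposite C U → Insert b e U U′ → length c + suc (length Us) ≡ n →
               ∫xh c (U′ ∷ Us) ≡ Σℤ (map (λ T → ∫xh (c ∷ʳ T) Us) (containing b e))
  ∫xh-insert {c} {C} {U} {U′} {b} {e} Us chain c-nonEmpty opp ins degree = begin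
    ∫xh c (U′ ∷ Us)                                  ≡⟨ ∫xh-∷ c U′ Us ⟩
    Σℤ (map f (meeting U′))                          ≡⟨ Σℤ-filter (λ T → meets? T U′) f (allCol n r) ⟩
    Σℤ (map (restrict (λ T → meets? T U′) f) (allCol n r))
      ≡⟨ Σℤ-cong (All.universal same-summand (allCol n r)) ⟩
    Σℤ (map (restrict (_∋? (b , e)) f) (allCol n r)) ≡⟨ sym (Σℤ-filter (_∋? (b , e)) f (allCol n r)) ⟩
    Σℤ (map f (containing b e))                      ∎
    where
    open ≡-Reasoning
    f : Col n r → ℤ
    f T = ∫xh (c ∷ʳ T) Us

    same-summand : ∀ T → restrict (λ T → meets? T U′) f T ≡ restrict (_∋? (b , e)) f T
    same-summand T with meets? T U′ | T ∋? (b , e)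
    ... | yes _    | yes _  = refl
    ... | no _     | no _   = refl
    ... | no ¬meet | yes T∋ = ⊥-elim (¬meet (b , e , T∋ , Insert.added ins))
    ... | yes meet | no T∌ with meets-insert {T = T} ins meet
    ...   | inj₁ T∋                 = ⊥-elim (T∌ T∋)
    ...   | inj₂ (i , a , T∋ , U∋) =
      ∫xh-incomparable Us chain c-nonEmpty (i , a , T∋) (opposite-incomparable {C = C} {U} {T} opp T∋ U∋) degree

  ∫xh-clash : ∀ {c C b x} (Us : List (Col n r)) → ChainTo c C → All NonEmpty c → C ∋ (b , x) →
              (a : Fin r) → a ≢ x → length c + suc (length Us) ≡ n →
              Σℤ (map (λ T → ∫xh (c ∷ʳ T) Us) (containing b a)) ≡ 0ℤ
  ∫xh-clash {C = C} {b} Us chain c-nonEmpty C∋ a a≢x degree =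
    Σℤ-zero (All.map (λ {T} T∋ → ∫xh-incomparable Us chain c-nonEmpty (b , a , T∋)
                                   (clash-incomparable {C = C} {T} C∋ T∋ a≢x) degree)
                     (All.all-filter (_∋? (b , a)) (allCol n r)))

  Dichotomy : List (Col n r) → Col n r → Col n r → List (Col n r) → Set
  Dichotomy c C U Us = (Supp⊈ C U → ∫xh c Us ≡ 0ℤ) × (Supp⊆ C U → ∫xh c Us ≡ 1ℤ)

  module Fresh {c C U U′ b e a} (Us : List (Col n r)) (chain : ChainTo c C) (c-nonEmpty : All NonEmpty c)
               (opp : Opposite C U) (ins : Insert b e U U′) (C-fresh : lookup C b ≡ nothing)
               (degree : length c + suc (length Us) ≡ n)
               (ih : ∀ {T} → T ∋ (b , a) → C ⊆c T → Dichotomy (c ∷ʳ T) T U′ Us) where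

    f : Col n r → ℤ
    f T = ∫xh (c ∷ʳ T) Us

    summand-vanishes : ∀ {T} → T ∋ (b , a) → (C ⊆c T → Supp⊈ T U′) → f T ≡ 0ℤ
    summand-vanishes {T} T∋ escapes with C ⊆? T
    ... | no C⊈T  = ∫xh-incomparable Us chain c-nonEmpty (b , a , T∋)
                                     (C⊈T , fresh-⊈ {C = C} {T} C-fresh T∋) degree
    ... | yes C⊆T = proj₁ (ih T∋ C⊆T) (escapes C⊆T)

    sum-if-⊈ : Supp⊈ C U → Σℤ (map f (containing b a)) ≡ 0ℤ
    sum-if-⊈ C⊈U =
      Σℤ-zero (All.map (λ {T} T∋ → summand-vanishes T∋ (supp⊈-insert {C = C} {T = T} C⊈U C-fresh ins))
                       (All.all-filter (_∋? (b , a)) (allCol n r)))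

    sum-if-⊆ : Supp⊆ C U → Σℤ (map f (containing b a)) ≡ 1ℤ
    sum-if-⊆ C⊆U = begin
      Σℤ (map f (containing b a))                   ≡⟨ Σℤ-filter (_∋? (b , a)) f (allCol n r) ⟩
      Σℤ (map (restrict (_∋? (b , a)) f) (allCol n r)) ≡⟨ Σℤ-allCol-delta _ C′ off-C′ ⟩
      restrict (_∋? (b , a)) f C′                   ≡⟨ restrict-yes (_∋? (b , a)) f C′∋ ⟩
      f C′                                          ≡⟨ proj₂ (ih C′∋ C⊆C′) (supp⊆-insert {C = C} C⊆U ins) ⟩
      1ℤ                                            ∎
      where
      open ≡-Reasoning
      C′ : Col n r
      C′ = C [ b ]≔ just a
      C′∋ : C′ ∋ (b , a)
      C′∋ = Vec.lookup∘update b C (just a)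
      C⊆C′ : C ⊆c C′
      C⊆C′ = fresh-⊆-update {C = C} C-fresh
      off-C′ : ∀ T → T ≢ C′ → restrict (_∋? (b , a)) f T ≡ 0ℤ
      off-C′ T T≢C′ with T ∋? (b , a)
      ... | no _   = refl
      ... | yes T∋ = summand-vanishes T∋ (λ C⊆T → supp⊈-off-update {C = C} {T = T} opp ins C⊆T T∋ T≢C′)

  ∫xh-saturated : ∀ {c C U Us} → 2 ≤ r → ChainTo c C → All NonEmpty c → Opposite C U → Saturated U Us →
                  length c + length Us ≡ n → Dichotomy c C U Us
  ∫xh-saturated {c} _ chain c-nonEmpty _ (full U-full) degree =
    (λ { (i , U-i , _) → ⊥-elim (U-full i U-i) }) ,
    (λ _ → trans (ℤ.+-identityʳ _)
                 (trans (cong φ (List.++-identityʳ c))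
                        (chain-1 c (trans (sym (ℕ.+-identityʳ _)) degree) c-nonEmpty (ChainTo⇒Chain chain))))
  ∫xh-saturated {c} {C} {U} {U′ ∷ Us} 2≤r chain c-nonEmpty opp (_∷_ {b = b} {e} ins saturated) degree
    with lookup C b in C-b
  ... | just x  =
    (λ _ → trans (∫xh-insert Us chain c-nonEmpty opp ins degree)
                 (trans (∫xh-recolour Us c-nonEmpty degree b e a)
                        (∫xh-clash {C = C} Us chain c-nonEmpty C-b a (another-≢ 2≤r x) degree))) ,
    (λ C⊆U → ⊥-elim (nothing≢just (trans (sym (C⊆U b (Insert.fresh ins))) C-b)))
    where
    a : Fin r
    a = another 2≤r x
  ... | nothing =
    (λ C⊈U → trans step (sum-if-⊈ C⊈U)) , (λ C⊆U → trans step (sum-if-⊆ C⊆U))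
    where
    a : Fin r
    a = another 2≤r e
    step : ∫xh c (U′ ∷ Us) ≡ Σℤ (map (λ T → ∫xh (c ∷ʳ T) Us) (containing b a))
    step = trans (∫xh-insert Us chain c-nonEmpty opp ins degree) (∫xh-recolour Us c-nonEmpty degree b e a)
    ih : ∀ {T} → T ∋ (b , a) → C ⊆c T → Dichotomy (c ∷ʳ T) T U′ Us
    ih {T} T∋ C⊆T =
      ∫xh-saturated 2≤r (chain ▸ fresh-⊊ {C = C} {T} C-b T∋ C⊆T) (All.++⁺ c-nonEmpty ((b , a , T∋) ∷ []))
                    (opposite-insert {C = C} {T = T} opp ins C⊆T T∋ (another-≢ 2≤r e))
                    saturated (length-∷ʳ c degree)
    open Fresh Us chain c-nonEmpty opp ins C-b degree ih

proposition6p5 : (n r : ℕ) → 2 ≤ r →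
    (S : List (Col n r)) → length S ≡ n → All NonEmpty S → Chain S →
    (φ : List (Col n r) → ℤ) → IsDegreeMap n r φ →
    ∫h φ S ≡ 1ℤ
proposition6p5 n r 2≤r S length-S nonEmpty chain φ φ-degree =
  proj₂ (∫xh-saturated 2≤r [] [] opposite-∅ (maximal-chain-saturated S length-S nonEmpty chain) length-S)
        supp⊆-∅
  where open Expansion φ φ-degree
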